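{- Let $(t_n)$ be the Thue–Morse sequence and let $P_n(x),Q_n(x)$ be the polynomials giving the canonical representation of the $n$-th convergent of the Stieltjes continued fraction with coefficients $a_n=t_n$ (defined in the context). Then $P_0(x)=P_1(x)=Q_0(x)=1$, $Q_1(x)=1-x$, and for all $m\ge1$ and $1\le\epsilon\le 2^m$, $$U_{2^{m+1}-\epsilon}(x)=Q_{2^m-\epsilon}(-x)\,U_{2^m-1}(x)-x\,P_{2^m-\epsilon}(-x)\,U_{2^m-2}(x),$$ where $U$ stands for either of the sequences $P$ or $Q$.
   Context: Thue–Morse sequence: $t_0=1$, $t_{2n}=t_n$ ($n\ge1$), $t_{2n+1}=-t_n$ ($n\ge0$). For a sequence $(a_n)$, polynomials $P_n,Q_n$ are defined by $P_0=a_0$, $Q_0=1$, $P_1=a_0$, $Q_1=1+a_1x$, and for $n\ge2$ $$\begin{pmatrix}1&a_nx\\1&0\end{pmatrix}\cdots\begin{pmatrix}1&a_2x\\1&0\end{pmatrix}\begin{pmatrix}P_1&Q_1\\P_0&Q_0\end{pmatrix}=\begin{pmatrix}P_n&Q_n\\P_{n-1}&Q_{n-1}\end{pmatrix},$$ so that $P_n/Q_n=a_0/(1+a_1x/(1+\cdots/(1+a_nx)))$. Here $a_n=t_n$. -}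

module Defs where

open import Data.Nat using (ℕ; zero; suc; _/_; _%_; _+_)
open import Data.Integer using (ℤ; 0ℤ; 1ℤ; -_) renaming (_+_ to _+ℤ_; _*_ to _*ℤ_)
open import Data.List using (List; []; _∷_)
open import Data.Product using (_×_; _,_; proj₁; proj₂)
open import Relation.Binary.PropositionalEquality using (_≡_)

-- Thue–Morse sequence: t 0 = 1, t (2n) = t n, t (2n+1) = - t n.
-- Defined with a fuel argument (fuel n+1 suffices since ⌊n/2⌋ < n for n ≥ 1).

tmF : ℕ → ℕ → ℤ
tmF zero    n       = 1ℤ
tmF (suc k) zero    = 1ℤ
tmF (suc k) (suc n) with (suc n) % 2
... | zero  = tmF k (suc n / 2)
... | suc _ = - tmF k (suc n / 2)

t : ℕ → ℤ
t n = tmF (suc n) n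

-- Polynomials in ℤ[x] as coefficient lists (constant term first).

Poly : Set
Poly = List ℤ

coeff : Poly → ℕ → ℤ
coeff []       _       = 0ℤ
coeff (a ∷ p)  zero    = a
coeff (a ∷ p)  (suc i) = coeff p i

infix 4 _≈ₚ_
_≈ₚ_ : Poly → Poly → Set
p ≈ₚ q = ∀ i → coeff p i ≡ coeff q i

infixl 6 _⊕_
_⊕_ : Poly → Poly → Poly
[]      ⊕ q       = q
p       ⊕ []      = p
(a ∷ p) ⊕ (b ∷ q) = (a +ℤ b) ∷ (p ⊕ q)

_·ₚ_ : ℤ → Poly → Poly
c ·ₚ []      = []
c ·ₚ (a ∷ p) = (c *ℤ a) ∷ (c ·ₚ p)

X* : Poly → Poly
X* p = 0ℤ ∷ p

infixl 7 _⊛_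
_⊛_ : Poly → Poly → Poly
[]      ⊛ q = []
(a ∷ p) ⊛ q = (a ·ₚ q) ⊕ X* (p ⊛ q)

negP : Poly → Poly
negP p = (- 1ℤ) ·ₚ p

subNeg : Poly → Poly
subNeg []      = []
subNeg (a ∷ p) = a ∷ negP (subNeg p)

-- Convergent polynomials P_n, Q_n of the Stieltjes continued fraction
-- with coefficients a_n.
-- rows a n = ((P_{n+1}, Q_{n+1}), (P_n, Q_n)), the matrix
-- ( P_{n+1} Q_{n+1} ; P_n Q_n ).  Multiplying on the left by
-- ( 1  a_{n+2} x ; 1 0 ) gives the next matrix.

rows : (ℕ → ℤ) → ℕ → (Poly × Poly) × (Poly × Poly)
rows a zero = ((a 0 ∷ []) , (1ℤ ∷ a 1 ∷ [])) , ((a 0 ∷ []) , (1ℤ ∷ []))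
rows a (suc n) with rows a n
... | (p1 , q1) , (p0 , q0) =
  ((p1 ⊕ (a (n + 2) ·ₚ X* p0)) , (q1 ⊕ (a (n + 2) ·ₚ X* q0))) , (p1 , q1)

Pc : (ℕ → ℤ) → ℕ → Poly
Pc a n = proj₁ (proj₂ (rows a n))

Qc : (ℕ → ℤ) → ℕ → Poly
Qc a n = proj₂ (proj₂ (rows a n))

P Q : ℕ → Poly
P = Pc t
Q = Qc t

-- With K = 2^m the Thue–Morse sequence is antiperiodic on [0, 2K): t_{K+j} = -t_j for j < K.
-- Hence, as long as j + 2 < K, j ↦ U_{K+j} satisfies W_{j+2} = W_{j+1} - t_{j+2} x W_j: the recurrence
-- of the convergents with every coefficient negated.  Substituting x ↦ -x negates the coefficients as well, so
-- j ↦ Q_j(-x) U_{K-1} - x P_j(-x) U_{K-2} satisfies the same recurrence.  Both sequences equal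
-- U_{K-1} at j = -1 (taking P_{-1} = 0, Q_{-1} = 1) and U_K at j = 0, so they agree for all j < K;
-- j = K - ε is the claim.

module Submission where

open import Defs
open import Data.Nat using (ℕ; zero; suc; pred; _+_; _*_; _^_; _∸_; _<_; _≤_; _/_; _%_; s≤s; z≤n)
open import Data.Nat.Properties
open import Data.Nat.DivMod using (m*n%n≡0; m*n/n≡m; [m+kn]%n≡m%n; +-distrib-/-∣ʳ; m/n<m)
open import Data.Nat.Divisibility using (divides-refl)
open import Data.Integer using (ℤ; 0ℤ; 1ℤ; -1ℤ; -_) renaming (_+_ to _+ℤ_; _*_ to _*ℤ_)
import Data.Integer.Properties as ℤ
open import Data.Integer.Tactic.RingSolver using (solve-∀)
open import Data.List using ([]; _∷_)
open import Data.Product using (_×_; ∃-syntax; _,_)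
open import Data.Sum using (_⊎_; inj₁; inj₂)
open import Function using (id; _∘_)
open import Relation.Binary.Bundles using (Setoid)
import Relation.Binary.Reasoning.Setoid as SetoidReasoning
open import Relation.Binary.PropositionalEquality

-- Thue–Morse antiperiodicity

negateUnless0 : ℕ → ℤ → ℤ
negateUnless0 zero    v = v
negateUnless0 (suc _) v = - v

tmF-suc : ∀ k n → tmF (suc k) (suc n) ≡ negateUnless0 (suc n % 2) (tmF k (suc n / 2))
tmF-suc k n with suc n % 2
... | zero  = refl
... | suc _ = refl

suc[n]/2<suc[n] : ∀ n → suc n / 2 < suc n
suc[n]/2<suc[n] n = m/n<m (suc n) 2 (s≤s (s≤s z≤n))

tmF-fuel : ∀ {k k′ n} → n < k → n < k′ → tmF k n ≡ tmF k′ n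
tmF-fuel {suc k} {suc k′} {zero}  _         _          = refl
tmF-fuel {suc k} {suc k′} {suc n} (s≤s n<k) (s≤s n<k′) = begin
  tmF (suc k) (suc n)                             ≡⟨ tmF-suc k n ⟩
  negateUnless0 (suc n % 2) (tmF k (suc n / 2))   ≡⟨ cong (negateUnless0 (suc n % 2))
                                                        (tmF-fuel (<-≤-trans half n<k) (<-≤-trans half n<k′)) ⟩
  negateUnless0 (suc n % 2) (tmF k′ (suc n / 2))  ≡⟨ tmF-suc k′ n ⟨
  tmF (suc k′) (suc n)                            ∎
  where open ≡-Reasoning
        half = suc[n]/2<suc[n] n

t-suc : ∀ n → t (suc n) ≡ negateUnless0 (suc n % 2) (t (suc n / 2))
t-suc n = trans (tmF-suc (suc n) n)
  (cong (negateUnless0 (suc n % 2)) (tmF-fuel (suc[n]/2<suc[n] n) (n<1+n _)))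

t-even : ∀ n → t (n * 2) ≡ t n
t-even zero    = refl
t-even (suc n) = trans (t-suc (suc (n * 2)))
  (cong₂ negateUnless0 (m*n%n≡0 (suc n) 2) (cong t (m*n/n≡m (suc n) 2)))

t-odd : ∀ n → t (1 + n * 2) ≡ - t n
t-odd n = trans (t-suc (n * 2))
  (cong₂ negateUnless0 ([m+kn]%n≡m%n 1 n 2)
    (cong t (trans (+-distrib-/-∣ʳ 1 {d = 2} (divides-refl n)) (m*n/n≡m n 2))))

even-or-odd : ∀ j → ∃[ q ] (j ≡ q * 2 ⊎ j ≡ 1 + q * 2)
even-or-odd zero = 0 , inj₁ refl
even-or-odd (suc j) with even-or-odd j
... | q , inj₁ j≡2q   = q ,     inj₂ (cong suc j≡2q)
... | q , inj₂ j≡2q+1 = suc q , inj₁ (cong suc j≡2q+1)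

2^[1+m]+q*2≡[2^m+q]*2 : ∀ m q → 2 ^ suc m + q * 2 ≡ (2 ^ m + q) * 2
2^[1+m]+q*2≡[2^m+q]*2 m q = trans (cong (_+ q * 2) (*-comm 2 (2 ^ m))) (sym (*-distribʳ-+ 2 (2 ^ m) q))

t[2^m+j]≡-t[j] : ∀ m j → j < 2 ^ m → t (2 ^ m + j) ≡ - t j
t[2^m+j]≡-t[j] zero    zero    _ = refl
t[2^m+j]≡-t[j] zero    (suc j) (s≤s ())
t[2^m+j]≡-t[j] (suc m) j j<2^[1+m] with even-or-odd j
... | q , inj₁ refl = begin
  t (2 ^ suc m + q * 2)   ≡⟨ cong t (2^[1+m]+q*2≡[2^m+q]*2 m q) ⟩
  t ((2 ^ m + q) * 2)     ≡⟨ t-even (2 ^ m + q) ⟩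
  t (2 ^ m + q)           ≡⟨ t[2^m+j]≡-t[j] m q (half j<2^[1+m]) ⟩
  - t q                   ≡⟨ cong -_ (t-even q) ⟨
  - t (q * 2)             ∎
  where open ≡-Reasoning
        half : q * 2 < 2 ^ suc m → q < 2 ^ m
        half lt = *-cancelʳ-< 2 q (2 ^ m) (subst (q * 2 <_) (*-comm 2 (2 ^ m)) lt)
... | q , inj₂ refl = begin
  t (2 ^ suc m + (1 + q * 2))  ≡⟨ cong t (trans (+-suc (2 ^ suc m) (q * 2))
                                                 (cong suc (2^[1+m]+q*2≡[2^m+q]*2 m q))) ⟩
  t (1 + (2 ^ m + q) * 2)      ≡⟨ t-odd (2 ^ m + q) ⟩
  - t (2 ^ m + q)              ≡⟨ cong -_ (t[2^m+j]≡-t[j] m q (half j<2^[1+m])) ⟩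
  - - t q                      ≡⟨ cong -_ (t-odd q) ⟨
  - t (1 + q * 2)              ∎
  where open ≡-Reasoning
        half : 1 + q * 2 < 2 ^ suc m → q < 2 ^ m
        half lt = *-cancelʳ-< 2 q (2 ^ m) (subst (q * 2 <_) (*-comm 2 (2 ^ m)) (<-trans (n<1+n _) lt))

-- Polynomials up to coefficientwise equality

-- A record rather than ≈ₚ itself, so that both polynomials can be inferred from a proof.
infix 4 _≋_
record _≋_ (p q : Poly) : Set where
  constructor coeffwise
  field coeff-≡ : p ≈ₚ q
open _≋_ public

≋-setoid : Setoid _ _
≋-setoid = record
  { Carrier       = Poly
  ; _≈_           = _≋_
  ; isEquivalence = record
    { refl  = coeffwise λ _ → refl
    ; sym   = λ (coeffwise e) → coeffwise λ i → sym (e i)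
    ; trans = λ (coeffwise e) (coeffwise f) → coeffwise λ i → trans (e i) (f i)
    }
  }

open Setoid ≋-setoid public
  using () renaming (refl to ≋-refl; sym to ≋-sym; trans to ≋-trans; reflexive to ≋-reflexive)
module ≋-Reasoning = SetoidReasoning ≋-setoid

coeff-⊕ : ∀ p q i → coeff (p ⊕ q) i ≡ coeff p i +ℤ coeff q i
coeff-⊕ []      q       i       = sym (ℤ.+-identityˡ _)
coeff-⊕ (a ∷ p) []      i       = sym (ℤ.+-identityʳ _)
coeff-⊕ (a ∷ p) (b ∷ q) zero    = refl
coeff-⊕ (a ∷ p) (b ∷ q) (suc i) = coeff-⊕ p q i

coeff-·ₚ : ∀ c p i → coeff (c ·ₚ p) i ≡ c *ℤ coeff p i
coeff-·ₚ c []      i       = sym (ℤ.*-zeroʳ c)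
coeff-·ₚ c (a ∷ p) zero    = refl
coeff-·ₚ c (a ∷ p) (suc i) = coeff-·ₚ c p i

altSign : ℕ → ℤ
altSign zero    = 1ℤ
altSign (suc i) = - altSign i

coeff-subNeg : ∀ p i → coeff (subNeg p) i ≡ altSign i *ℤ coeff p i
coeff-subNeg []      i       = sym (ℤ.*-zeroʳ (altSign i))
coeff-subNeg (a ∷ p) zero    = sym (ℤ.*-identityˡ a)
coeff-subNeg (a ∷ p) (suc i) = begin
  coeff (negP (subNeg p)) i         ≡⟨ coeff-·ₚ -1ℤ (subNeg p) i ⟩
  -1ℤ *ℤ coeff (subNeg p) i         ≡⟨ cong (-1ℤ *ℤ_) (coeff-subNeg p i) ⟩
  -1ℤ *ℤ (altSign i *ℤ coeff p i)   ≡⟨ ℤ.-1*i≡-i _ ⟩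
  - (altSign i *ℤ coeff p i)        ≡⟨ ℤ.neg-distribˡ-* (altSign i) (coeff p i) ⟩
  - altSign i *ℤ coeff p i          ∎
  where open ≡-Reasoning

⊕-cong : ∀ {p p′ q q′} → p ≋ p′ → q ≋ q′ → p ⊕ q ≋ p′ ⊕ q′
⊕-cong {p} {p′} {q} {q′} (coeffwise e) (coeffwise f) = coeffwise λ i →
  trans (coeff-⊕ p q i) (trans (cong₂ _+ℤ_ (e i) (f i)) (sym (coeff-⊕ p′ q′ i)))

⊕-congˡ : ∀ p {q q′} → q ≋ q′ → p ⊕ q ≋ p ⊕ q′
⊕-congˡ p = ⊕-cong (≋-refl {p})

⊕-congʳ : ∀ q {p p′} → p ≋ p′ → p ⊕ q ≋ p′ ⊕ q
⊕-congʳ q p≋p′ = ⊕-cong p≋p′ (≋-refl {q})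

·ₚ-congʳ : ∀ c {p p′} → p ≋ p′ → c ·ₚ p ≋ c ·ₚ p′
·ₚ-congʳ c {p} {p′} (coeffwise e) = coeffwise λ i →
  trans (coeff-·ₚ c p i) (trans (cong (c *ℤ_) (e i)) (sym (coeff-·ₚ c p′ i)))

X*-cong : ∀ {p p′} → p ≋ p′ → X* p ≋ X* p′
X*-cong (coeffwise e) = coeffwise λ { zero → refl ; (suc i) → e i }

subNeg-cong : ∀ {p p′} → p ≋ p′ → subNeg p ≋ subNeg p′
subNeg-cong {p} {p′} (coeffwise e) = coeffwise λ i →
  trans (coeff-subNeg p i) (trans (cong (altSign i *ℤ_) (e i)) (sym (coeff-subNeg p′ i)))

⊕-identityʳ : ∀ p → p ⊕ [] ≋ p
⊕-identityʳ []      = ≋-refl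
⊕-identityʳ (a ∷ p) = ≋-refl

⊕-interchange : ∀ p q r s → (p ⊕ q) ⊕ (r ⊕ s) ≋ (p ⊕ r) ⊕ (q ⊕ s)
⊕-interchange p q r s = coeffwise λ i →
  begin
    coeff ((p ⊕ q) ⊕ (r ⊕ s)) i                           ≡⟨ expand p q r s i ⟩
    (coeff p i +ℤ coeff q i) +ℤ (coeff r i +ℤ coeff s i)  ≡⟨ interchange (coeff p i) (coeff q i) (coeff r i) (coeff s i) ⟩
    (coeff p i +ℤ coeff r i) +ℤ (coeff q i +ℤ coeff s i)  ≡⟨ expand p r q s i ⟨
    coeff ((p ⊕ r) ⊕ (q ⊕ s)) i                           ∎
  where
  open ≡-Reasoning
  expand : ∀ w x y z i →
           coeff ((w ⊕ x) ⊕ (y ⊕ z)) i ≡ (coeff w i +ℤ coeff x i) +ℤ (coeff y i +ℤ coeff z i)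
  expand w x y z i = trans (coeff-⊕ (w ⊕ x) (y ⊕ z) i) (cong₂ _+ℤ_ (coeff-⊕ w x i) (coeff-⊕ y z i))
  interchange : ∀ w x y z → (w +ℤ x) +ℤ (y +ℤ z) ≡ (w +ℤ y) +ℤ (x +ℤ z)
  interchange = solve-∀

·ₚ-distribˡ-⊕ : ∀ c p q → c ·ₚ (p ⊕ q) ≋ c ·ₚ p ⊕ c ·ₚ q
·ₚ-distribˡ-⊕ c p q = coeffwise λ i → begin
  coeff (c ·ₚ (p ⊕ q)) i
    ≡⟨ trans (coeff-·ₚ c (p ⊕ q) i) (cong (c *ℤ_) (coeff-⊕ p q i)) ⟩
  c *ℤ (coeff p i +ℤ coeff q i)
    ≡⟨ ℤ.*-distribˡ-+ c (coeff p i) (coeff q i) ⟩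
  c *ℤ coeff p i +ℤ c *ℤ coeff q i
    ≡⟨ trans (coeff-⊕ (c ·ₚ p) (c ·ₚ q) i) (cong₂ _+ℤ_ (coeff-·ₚ c p i) (coeff-·ₚ c q i)) ⟨
  coeff (c ·ₚ p ⊕ c ·ₚ q) i
    ∎
  where open ≡-Reasoning

·ₚ-distribʳ-+ : ∀ c d p → (c +ℤ d) ·ₚ p ≋ c ·ₚ p ⊕ d ·ₚ p
·ₚ-distribʳ-+ c d p = coeffwise λ i → begin
  coeff ((c +ℤ d) ·ₚ p) i
    ≡⟨ coeff-·ₚ (c +ℤ d) p i ⟩
  (c +ℤ d) *ℤ coeff p i
    ≡⟨ ℤ.*-distribʳ-+ (coeff p i) c d ⟩
  c *ℤ coeff p i +ℤ d *ℤ coeff p i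
    ≡⟨ trans (coeff-⊕ (c ·ₚ p) (d ·ₚ p) i) (cong₂ _+ℤ_ (coeff-·ₚ c p i) (coeff-·ₚ d p i)) ⟨
  coeff (c ·ₚ p ⊕ d ·ₚ p) i
    ∎
  where open ≡-Reasoning

·ₚ-assoc : ∀ c d p → (c *ℤ d) ·ₚ p ≋ c ·ₚ (d ·ₚ p)
·ₚ-assoc c d p = coeffwise λ i → begin
  coeff ((c *ℤ d) ·ₚ p) i
    ≡⟨ coeff-·ₚ (c *ℤ d) p i ⟩
  (c *ℤ d) *ℤ coeff p i
    ≡⟨ ℤ.*-assoc c d (coeff p i) ⟩
  c *ℤ (d *ℤ coeff p i)
    ≡⟨ trans (coeff-·ₚ c (d ·ₚ p) i) (cong (c *ℤ_) (coeff-·ₚ d p i)) ⟨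
  coeff (c ·ₚ (d ·ₚ p)) i
    ∎
  where open ≡-Reasoning

·ₚ-identityˡ : ∀ p → 1ℤ ·ₚ p ≋ p
·ₚ-identityˡ p = coeffwise λ i → trans (coeff-·ₚ 1ℤ p i) (ℤ.*-identityˡ (coeff p i))

·ₚ-zeroˡ : ∀ p → 0ℤ ·ₚ p ≋ []
·ₚ-zeroˡ p = coeffwise (coeff-·ₚ 0ℤ p)

X*-⊕ : ∀ p q → X* (p ⊕ q) ≋ X* p ⊕ X* q
X*-⊕ p q = coeffwise λ { zero → refl ; (suc i) → refl }

X*-·ₚ : ∀ c p → X* (c ·ₚ p) ≋ c ·ₚ X* p
X*-·ₚ c p = coeffwise λ { zero → sym (ℤ.*-zeroʳ c) ; (suc i) → refl }

X*-[] : X* [] ≋ []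
X*-[] = coeffwise λ { zero → refl ; (suc i) → refl }

subNeg-⊕ : ∀ p q → subNeg (p ⊕ q) ≋ subNeg p ⊕ subNeg q
subNeg-⊕ p q = coeffwise λ i → begin
  coeff (subNeg (p ⊕ q)) i
    ≡⟨ trans (coeff-subNeg (p ⊕ q) i) (cong (altSign i *ℤ_) (coeff-⊕ p q i)) ⟩
  altSign i *ℤ (coeff p i +ℤ coeff q i)
    ≡⟨ ℤ.*-distribˡ-+ (altSign i) (coeff p i) (coeff q i) ⟩
  altSign i *ℤ coeff p i +ℤ altSign i *ℤ coeff q i
    ≡⟨ trans (coeff-⊕ (subNeg p) (subNeg q) i) (cong₂ _+ℤ_ (coeff-subNeg p i) (coeff-subNeg q i)) ⟨
  coeff (subNeg p ⊕ subNeg q) i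
    ∎
  where open ≡-Reasoning

subNeg-·ₚ : ∀ c p → subNeg (c ·ₚ p) ≋ c ·ₚ subNeg p
subNeg-·ₚ c p = coeffwise λ i → begin
  coeff (subNeg (c ·ₚ p)) i
    ≡⟨ trans (coeff-subNeg (c ·ₚ p) i) (cong (altSign i *ℤ_) (coeff-·ₚ c p i)) ⟩
  altSign i *ℤ (c *ℤ coeff p i)
    ≡⟨ swap (altSign i) c (coeff p i) ⟩
  c *ℤ (altSign i *ℤ coeff p i)
    ≡⟨ trans (coeff-·ₚ c (subNeg p) i) (cong (c *ℤ_) (coeff-subNeg p i)) ⟨
  coeff (c ·ₚ subNeg p) i
    ∎
  where open ≡-Reasoning
        swap : ∀ s c x → s *ℤ (c *ℤ x) ≡ c *ℤ (s *ℤ x)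
        swap = solve-∀

⊛-⊕ˡ : ∀ p q r → (p ⊕ q) ⊛ r ≋ p ⊛ r ⊕ q ⊛ r
⊛-⊕ˡ []      q       r = ≋-refl
⊛-⊕ˡ (a ∷ p) []      r = ≋-sym (⊕-identityʳ ((a ∷ p) ⊛ r))
⊛-⊕ˡ (a ∷ p) (b ∷ q) r = begin
  (a +ℤ b) ·ₚ r ⊕ X* ((p ⊕ q) ⊛ r)               ≈⟨ ⊕-cong (·ₚ-distribʳ-+ a b r) (X*-cong (⊛-⊕ˡ p q r)) ⟩
  (a ·ₚ r ⊕ b ·ₚ r) ⊕ X* (p ⊛ r ⊕ q ⊛ r)          ≈⟨ ⊕-congˡ (a ·ₚ r ⊕ b ·ₚ r) (X*-⊕ (p ⊛ r) (q ⊛ r)) ⟩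
  (a ·ₚ r ⊕ b ·ₚ r) ⊕ (X* (p ⊛ r) ⊕ X* (q ⊛ r))   ≈⟨ ⊕-interchange (a ·ₚ r) (b ·ₚ r) _ _ ⟩
  (a ·ₚ r ⊕ X* (p ⊛ r)) ⊕ (b ·ₚ r ⊕ X* (q ⊛ r))   ∎
  where open ≋-Reasoning

⊛-·ₚ : ∀ c p r → (c ·ₚ p) ⊛ r ≋ c ·ₚ (p ⊛ r)
⊛-·ₚ c []      r = ≋-refl
⊛-·ₚ c (a ∷ p) r = begin
  (c *ℤ a) ·ₚ r ⊕ X* ((c ·ₚ p) ⊛ r)   ≈⟨ ⊕-cong (·ₚ-assoc c a r) (X*-cong (⊛-·ₚ c p r)) ⟩
  c ·ₚ (a ·ₚ r) ⊕ X* (c ·ₚ (p ⊛ r))    ≈⟨ ⊕-congˡ (c ·ₚ (a ·ₚ r)) (X*-·ₚ c (p ⊛ r)) ⟩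
  c ·ₚ (a ·ₚ r) ⊕ c ·ₚ X* (p ⊛ r)      ≈⟨ ·ₚ-distribˡ-⊕ c (a ·ₚ r) (X* (p ⊛ r)) ⟨
  c ·ₚ (a ·ₚ r ⊕ X* (p ⊛ r))           ∎
  where open ≋-Reasoning

X*-⊛ : ∀ p r → X* p ⊛ r ≋ X* (p ⊛ r)
X*-⊛ p r = ⊕-congʳ (X* (p ⊛ r)) (·ₚ-zeroˡ r)

constant-⊛ : ∀ c r → (c ∷ []) ⊛ r ≋ c ·ₚ r
constant-⊛ c r = ≋-trans (⊕-congˡ (c ·ₚ r) X*-[]) (⊕-identityʳ (c ·ₚ r))

⊛-zeroˡ : ∀ {p} r → p ≋ [] → p ⊛ r ≋ []
⊛-zeroˡ {[]}    r _               = ≋-refl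
⊛-zeroˡ {a ∷ p} r (coeffwise p≈0) = begin
  a ·ₚ r ⊕ X* (p ⊛ r)   ≈⟨ ⊕-cong (≋-reflexive (cong (_·ₚ r) (p≈0 zero)))
                                   (X*-cong (⊛-zeroˡ {p} r (coeffwise (p≈0 ∘ suc)))) ⟩
  0ℤ ·ₚ r ⊕ X* []       ≈⟨ ⊕-cong (·ₚ-zeroˡ r) X*-[] ⟩
  []                    ∎
  where open ≋-Reasoning

⊛-congˡ : ∀ r {p p′} → p ≋ p′ → p ⊛ r ≋ p′ ⊛ r
⊛-congˡ r {[]}    {p′}     p≈p′ = ≋-sym (⊛-zeroˡ r (≋-sym p≈p′))
⊛-congˡ r {a ∷ p} {[]}     p≈p′ = ⊛-zeroˡ r p≈p′
⊛-congˡ r {a ∷ p} {b ∷ p′} (coeffwise p≈p′) =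
  ⊕-cong (≋-reflexive (cong (_·ₚ r) (p≈p′ zero)))
         (X*-cong (⊛-congˡ r {p} {p′} (coeffwise (p≈p′ ∘ suc))))

subNeg-step : ∀ u e v → subNeg (u ⊕ e ·ₚ X* v) ≋ subNeg u ⊕ (- e) ·ₚ X* (subNeg v)
subNeg-step u e v = begin
  subNeg (u ⊕ e ·ₚ X* v)                   ≈⟨ subNeg-⊕ u (e ·ₚ X* v) ⟩
  u′ ⊕ subNeg (e ·ₚ X* v)                  ≈⟨ ⊕-congˡ u′ (subNeg-·ₚ e (X* v)) ⟩
  u′ ⊕ e ·ₚ X* (negP (subNeg v))           ≈⟨ ⊕-congˡ u′ (·ₚ-congʳ e (X*-·ₚ -1ℤ (subNeg v))) ⟩
  u′ ⊕ e ·ₚ (-1ℤ ·ₚ X* (subNeg v))         ≈⟨ ⊕-congˡ u′ (·ₚ-assoc e -1ℤ (X* (subNeg v))) ⟨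
  u′ ⊕ (e *ℤ -1ℤ) ·ₚ X* (subNeg v)         ≡⟨ cong (λ d → u′ ⊕ d ·ₚ X* (subNeg v)) (trans (ℤ.*-comm e -1ℤ) (ℤ.-1*i≡-i e)) ⟩
  u′ ⊕ (- e) ·ₚ X* (subNeg v)              ∎
  where open ≋-Reasoning
        u′ = subNeg u

⊛-step : ∀ r u e v → (u ⊕ e ·ₚ X* v) ⊛ r ≋ u ⊛ r ⊕ e ·ₚ X* (v ⊛ r)
⊛-step r u e v = begin
  (u ⊕ e ·ₚ X* v) ⊛ r            ≈⟨ ⊛-⊕ˡ u (e ·ₚ X* v) r ⟩
  u ⊛ r ⊕ (e ·ₚ X* v) ⊛ r        ≈⟨ ⊕-congˡ (u ⊛ r) (⊛-·ₚ e (X* v) r) ⟩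
  u ⊛ r ⊕ e ·ₚ (X* v ⊛ r)        ≈⟨ ⊕-congˡ (u ⊛ r) (·ₚ-congʳ e (X*-⊛ v r)) ⟩
  u ⊛ r ⊕ e ·ₚ X* (v ⊛ r)        ∎
  where open ≋-Reasoning

X*-step : ∀ u e v → X* (u ⊕ e ·ₚ X* v) ≋ X* u ⊕ e ·ₚ X* (X* v)
X*-step u e v = ≋-trans (X*-⊕ u (e ·ₚ X* v)) (⊕-congˡ (X* u) (X*-·ₚ e (X* v)))

·ₚ-step : ∀ c u e v → c ·ₚ (u ⊕ e ·ₚ X* v) ≋ c ·ₚ u ⊕ e ·ₚ X* (c ·ₚ v)
·ₚ-step c u e v = begin
  c ·ₚ (u ⊕ e ·ₚ X* v)           ≈⟨ ·ₚ-distribˡ-⊕ c u (e ·ₚ X* v) ⟩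
  c ·ₚ u ⊕ c ·ₚ (e ·ₚ X* v)      ≈⟨ ⊕-congˡ (c ·ₚ u) (·ₚ-assoc c e (X* v)) ⟨
  c ·ₚ u ⊕ (c *ℤ e) ·ₚ X* v     ≡⟨ cong (λ d → c ·ₚ u ⊕ d ·ₚ X* v) (ℤ.*-comm c e) ⟩
  c ·ₚ u ⊕ (e *ℤ c) ·ₚ X* v     ≈⟨ ⊕-congˡ (c ·ₚ u) (·ₚ-assoc e c (X* v)) ⟩
  c ·ₚ u ⊕ e ·ₚ (c ·ₚ X* v)      ≈⟨ ⊕-congˡ (c ·ₚ u) (·ₚ-congʳ e (X*-·ₚ c v)) ⟨
  c ·ₚ u ⊕ e ·ₚ X* (c ·ₚ v)      ∎
  where open ≋-Reasoning

-- Second-order recurrences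

record Solves (c : ℕ → ℤ) (W : ℕ → Poly) : Set where
  field recurrence : ∀ n → W (suc (suc n)) ≋ W (suc n) ⊕ c (suc (suc n)) ·ₚ X* (W n)
open Solves public

solves-shift : ∀ {c W} → Solves c W → ∀ s → Solves (λ k → c (k + s)) (λ k → W (k + s))
recurrence (solves-shift W-solves s) k = recurrence W-solves (k + s)

solves-map : ∀ {c W} (L : Poly → Poly) (f : ℤ → ℤ) →
             (∀ {p q} → p ≋ q → L p ≋ L q) →
             (∀ u e v → L (u ⊕ e ·ₚ X* v) ≋ L u ⊕ f e ·ₚ X* (L v)) →
             Solves c W → Solves (f ∘ c) (L ∘ W)
recurrence (solves-map L f L-cong L-step W-solves) n = ≋-trans (L-cong (recurrence W-solves n)) (L-step _ _ _)

solves-⊕ : ∀ {c W W′} → Solves c W → Solves c W′ → Solves c (λ n → W n ⊕ W′ n)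
recurrence (solves-⊕ {c} {W} {W′} W-solves W′-solves) n = begin
  W (suc (suc n)) ⊕ W′ (suc (suc n))
    ≈⟨ ⊕-cong (recurrence W-solves n) (recurrence W′-solves n) ⟩
  (W (suc n) ⊕ e ·ₚ X* (W n)) ⊕ (W′ (suc n) ⊕ e ·ₚ X* (W′ n))
    ≈⟨ ⊕-interchange (W (suc n)) _ _ _ ⟩
  S ⊕ (e ·ₚ X* (W n) ⊕ e ·ₚ X* (W′ n))
    ≈⟨ ⊕-congˡ S (·ₚ-distribˡ-⊕ e (X* (W n)) (X* (W′ n))) ⟨
  S ⊕ e ·ₚ (X* (W n) ⊕ X* (W′ n))
    ≈⟨ ⊕-congˡ S (·ₚ-congʳ e (X*-⊕ (W n) (W′ n))) ⟨
  S ⊕ e ·ₚ X* (W n ⊕ W′ n)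
    ∎
  where open ≋-Reasoning
        e = c (suc (suc n))
        S = W (suc n) ⊕ W′ (suc n)

solutions-agree : ∀ {c c′ W W′} → Solves c W → Solves c′ W′ → W 0 ≋ W′ 0 → W 1 ≋ W′ 1 →
                  ∀ {N} → (∀ n → n < N → c (suc (suc n)) ≡ c′ (suc (suc n))) →
                  ∀ j → j < suc (suc N) → W j ≋ W′ j
solutions-agree _ _ W₀≋W′₀ _ _ zero          _ = W₀≋W′₀
solutions-agree _ _ _ W₁≋W′₁ _ (suc zero)    _ = W₁≋W′₁
solutions-agree {c} {c′} {W} {W′} W-solves W′-solves W₀≋W′₀ W₁≋W′₁ {N} c≡c′ (suc (suc n)) (s≤s (s≤s n<N)) =
  begin
    W (suc (suc n))                      ≈⟨ recurrence W-solves n ⟩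
    W (suc n) ⊕ e ·ₚ X* (W n)            ≈⟨ ⊕-cong (agree (suc n) (s≤s n<N+1))
                                                   (·ₚ-congʳ e (X*-cong (agree n (m<n⇒m<1+n n<N+1)))) ⟩
    W′ (suc n) ⊕ e ·ₚ X* (W′ n)          ≡⟨ cong (λ d → W′ (suc n) ⊕ d ·ₚ X* (W′ n)) (c≡c′ n n<N) ⟩
    W′ (suc n) ⊕ e′ ·ₚ X* (W′ n)         ≈⟨ recurrence W′-solves n ⟨
    W′ (suc (suc n))                     ∎
  where open ≋-Reasoning
        e = c (suc (suc n))
        e′ = c′ (suc (suc n))
        n<N+1 = m<n⇒m<1+n n<N
        agree = solutions-agree {c} {c′} {W} {W′} W-solves W′-solves W₀≋W′₀ W₁≋W′₁ {N} c≡c′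

Pc-rec : ∀ a n → Pc a (suc (suc n)) ≡ Pc a (suc n) ⊕ a (n + 2) ·ₚ X* (Pc a n)
Pc-rec a n with rows a n
... | _ = refl

Qc-rec : ∀ a n → Qc a (suc (suc n)) ≡ Qc a (suc n) ⊕ a (n + 2) ·ₚ X* (Qc a n)
Qc-rec a n with rows a n
... | _ = refl

Pc-solves : ∀ a → Solves a (Pc a)
recurrence (Pc-solves a) n =
  ≋-reflexive (trans (Pc-rec a n) (cong (λ k → Pc a (suc n) ⊕ a k ·ₚ X* (Pc a n)) (+-comm n 2)))

Qc-solves : ∀ a → Solves a (Qc a)
recurrence (Qc-solves a) n =
  ≋-reflexive (trans (Qc-rec a n) (cong (λ k → Qc a (suc n) ⊕ a k ·ₚ X* (Qc a n)) (+-comm n 2)))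

-- Pc⁻ a j = P_{j-1} and Qc⁻ a j = Q_{j-1}, where P_{-1} = 0, Q_{-1} = 1 extend the recurrence one step back.
Pc⁻ Qc⁻ : (ℕ → ℤ) → ℕ → Poly
Pc⁻ a zero    = []
Pc⁻ a (suc j) = Pc a j
Qc⁻ a zero    = 1ℤ ∷ []
Qc⁻ a (suc j) = Qc a j

Pc⁻-solves : ∀ a → Solves (a ∘ pred) (Pc⁻ a)
recurrence (Pc⁻-solves a) zero    = coeffwise λ
  { zero    → sym (trans (cong (a 0 +ℤ_) (ℤ.*-zeroʳ (a 1))) (ℤ.+-identityʳ (a 0)))
  ; (suc i) → refl }
recurrence (Pc⁻-solves a) (suc n) = recurrence (Pc-solves a) n

Qc⁻-solves : ∀ a → Solves (a ∘ pred) (Qc⁻ a)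
recurrence (Qc⁻-solves a) zero    = coeffwise λ
  { zero          → cong (1ℤ +ℤ_) (sym (ℤ.*-zeroʳ (a 1)))
  ; (suc zero)    → sym (ℤ.*-identityʳ (a 1))
  ; (suc (suc i)) → refl }
recurrence (Qc⁻-solves a) (suc n) = recurrence (Qc-solves a) n

module Twisted (A B : Poly) where

  twisted : Poly → Poly → Poly
  twisted q p = subNeg q ⊛ A ⊕ negP (X* (subNeg p ⊛ B))

  twisted-solves : ∀ {c Q P} → Solves c Q → Solves c P → Solves (λ n → - c n) (λ j → twisted (Q j) (P j))
  twisted-solves Q-solves P-solves =
    solves-⊕ (twist A Q-solves)
             (solves-map negP id (·ₚ-congʳ -1ℤ) (·ₚ-step -1ℤ)
               (solves-map X* id X*-cong X*-step (twist B P-solves)))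
    where
    twist : ∀ {c W} r → Solves c W → Solves (λ n → - c n) (λ j → subNeg (W j) ⊛ r)
    twist r = solves-map (_⊛ r) id (⊛-congˡ r) (⊛-step r) ∘ solves-map subNeg -_ subNeg-cong subNeg-step

  twisted-1-[] : twisted (1ℤ ∷ []) [] ≋ A
  twisted-1-[] = begin
    (1ℤ ∷ []) ⊛ A ⊕ negP (X* [])   ≈⟨ ⊕-cong (constant-⊛ 1ℤ A) (·ₚ-congʳ -1ℤ X*-[]) ⟩
    1ℤ ·ₚ A ⊕ []                   ≈⟨ ⊕-identityʳ (1ℤ ·ₚ A) ⟩
    1ℤ ·ₚ A                        ≈⟨ ·ₚ-identityˡ A ⟩
    A                              ∎
    where open ≋-Reasoning

  twisted-1-constant : ∀ a₀ → twisted (1ℤ ∷ []) (a₀ ∷ []) ≋ A ⊕ (- a₀) ·ₚ X* B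
  twisted-1-constant a₀ = begin
    (1ℤ ∷ []) ⊛ A ⊕ negP (X* ((a₀ ∷ []) ⊛ B))  ≈⟨ ⊕-cong (≋-trans (constant-⊛ 1ℤ A) (·ₚ-identityˡ A))
                                                           (·ₚ-congʳ -1ℤ (X*-cong (constant-⊛ a₀ B))) ⟩
    A ⊕ negP (X* (a₀ ·ₚ B))                     ≈⟨ ⊕-congˡ A (·ₚ-congʳ -1ℤ (X*-·ₚ a₀ B)) ⟩
    A ⊕ -1ℤ ·ₚ (a₀ ·ₚ X* B)                     ≈⟨ ⊕-congˡ A (·ₚ-assoc -1ℤ a₀ (X* B)) ⟨
    A ⊕ (-1ℤ *ℤ a₀) ·ₚ X* B                     ≡⟨ cong (λ d → A ⊕ d ·ₚ X* B) (ℤ.-1*i≡-i a₀) ⟩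
    A ⊕ (- a₀) ·ₚ X* B                          ∎
    where open ≋-Reasoning

open Twisted using (twisted)

doubling : ∀ {a U} → Solves a U → ∀ {K} → 2 ≤ K → (∀ j → j < K → a (j + K) ≡ - a j) →
           ∀ j → j < K → U (j + K) ≋ twisted (U (K ∸ 1)) (U (K ∸ 2)) (Qc a j) (Pc a j)
doubling U-solves {suc zero} (s≤s ())
doubling {a} {U} U-solves {suc (suc n)} _ antiperiodic j j<K =
  ≋-trans (≋-reflexive (cong U (+-suc j (suc n)))) (agree (suc j) (s≤s j<K))
  where
  open Twisted (U (suc n)) (U n) using (twisted-solves; twisted-1-[]; twisted-1-constant)
  W V : ℕ → Poly
  W k = U (k + suc n)
  V k = twisted (U (suc n)) (U n) (Qc⁻ a k) (Pc⁻ a k)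

  W₁≋V₁ : W 1 ≋ V 1
  W₁≋V₁ = ≋-trans (recurrence U-solves n)
    (≋-trans (≋-reflexive (cong (λ e → U (suc n) ⊕ e ·ₚ X* (U n)) (antiperiodic 0 (s≤s z≤n))))
             (≋-sym (twisted-1-constant (a 0))))

  coefficients-agree : ∀ k → k < suc n → a (suc (suc (k + suc n))) ≡ - a (suc k)
  coefficients-agree k k<n+1 =
    trans (cong (a ∘ suc) (sym (+-suc k (suc n)))) (antiperiodic (suc k) (s≤s k<n+1))

  agree : ∀ k → k < suc (suc (suc n)) → W k ≋ V k
  agree = solutions-agree (solves-shift U-solves (suc n))
            (twisted-solves (Qc⁻-solves a) (Pc⁻-solves a)) (≋-sym twisted-1-[]) W₁≋V₁ coefficients-agree

convergent-solves : ∀ (U : ℕ → Poly) → (U ≡ P ⊎ U ≡ Q) → Solves t U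
convergent-solves _ (inj₁ refl) = Pc-solves t
convergent-solves _ (inj₂ refl) = Qc-solves t

2≤2^[1+m] : ∀ m → 2 ≤ 2 ^ suc m
2≤2^[1+m] m = *-monoʳ-≤ 2 (m^n>0 2 m)

[2^m∸ε]+2^m≡2^[m+1]∸ε : ∀ m ε → ε ≤ 2 ^ m → (2 ^ m ∸ ε) + 2 ^ m ≡ 2 ^ (m + 1) ∸ ε
[2^m∸ε]+2^m≡2^[m+1]∸ε m ε ε≤2^m = begin
  (2 ^ m ∸ ε) + 2 ^ m        ≡⟨ +-∸-comm (2 ^ m) ε≤2^m ⟨
  (2 ^ m + 2 ^ m) ∸ ε        ≡⟨ cong (λ k → (2 ^ m + k) ∸ ε) (+-identityʳ (2 ^ m)) ⟨
  2 ^ suc m ∸ ε              ≡⟨ cong (λ k → 2 ^ k ∸ ε) (+-comm 1 m) ⟩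
  2 ^ (m + 1) ∸ ε            ∎
  where open ≡-Reasoning

thueMorse-doubling : ∀ m {U} → Solves t U → ∀ j → j < 2 ^ suc m →
                     U (j + 2 ^ suc m) ≋ twisted (U (2 ^ suc m ∸ 1)) (U (2 ^ suc m ∸ 2)) (Q j) (P j)
thueMorse-doubling m U-solves = doubling U-solves (2≤2^[1+m] m)
  (λ j j<2^[1+m] → trans (cong t (+-comm j (2 ^ suc m))) (t[2^m+j]≡-t[j] (suc m) j j<2^[1+m]))

lemma3p1 : (P 0 ≈ₚ 1ℤ ∷ []) × (P 1 ≈ₚ 1ℤ ∷ []) × (Q 0 ≈ₚ 1ℤ ∷ []) × (Q 1 ≈ₚ 1ℤ ∷ (- 1ℤ) ∷ [])
    × (∀ (m ε : ℕ) → 1 ≤ m → 1 ≤ ε → ε ≤ 2 ^ m →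
        ∀ (U : ℕ → Poly) → (U ≡ P ⊎ U ≡ Q) →
          U (2 ^ (m + 1) ∸ ε)
            ≈ₚ (subNeg (Q (2 ^ m ∸ ε)) ⊛ U (2 ^ m ∸ 1))
               ⊕ negP (X* (subNeg (P (2 ^ m ∸ ε)) ⊛ U (2 ^ m ∸ 2))))
lemma3p1 = (λ _ → refl) , (λ _ → refl) , (λ _ → refl) , (λ _ → refl) , λ
  { zero    _ ()
  ; (suc m) ε _ 1≤ε ε≤2^m U U∈PQ →
      coeff-≡ (≋-trans (≋-reflexive (cong U (sym ([2^m∸ε]+2^m≡2^[m+1]∸ε (suc m) ε ε≤2^m))))
                       (thueMorse-doubling m (convergent-solves U U∈PQ) (2 ^ suc m ∸ ε)
                                           (∸-monoʳ-< 1≤ε ε≤2^m)))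
  }
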